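{- Let $G$ be a graph. Then $b_L(G)\le b(G)+1$.
   Context: For a finite simple graph $H$, a burning sequence is a sequence $(b_1,\dots,b_t)$ of vertices such that every vertex $v$ satisfies $d_H(v,b_i)\le t-i$ for some $i\in\{1,\dots,t\}$; $b(H)$ is the minimum length of a burning sequence. The line graph $L(G)$ has vertex set $E(G)$, two vertices adjacent iff the edges share an endpoint. The edge burning number of $G$ is $b_L(G)=b(L(G))$. -}

module Defs where

open import Data.Nat using (ℕ; zero; suc; _∸_; _≤_)
open import Data.Fin using (Fin; toℕ) renaming (_<_ to _<ᶠ_)
open import Data.Vec using (Vec; lookup)
open import Data.Bool using (Bool; true)
open import Data.Product using (Σ; Σ-syntax; ∃-syntax; _×_; _,_)
open import Data.Sum using (_⊎_)
open import Relation.Nullary using (¬_)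
open import Relation.Binary.PropositionalEquality using (_≡_)

record Graph : Set₁ where
  field
    V   : Set
    Adj : V → V → Set

record SimpleGraph : Set where
  field
    n      : ℕ
    adj    : Fin n → Fin n → Bool
    sym    : ∀ u v → adj u v ≡ adj v u
    irrefl : ∀ v → ¬ (adj v v ≡ true)

module _ (H : Graph) where
  open Graph H

  -- Within k u v  :⇔  d_H(u,v) ≤ k  (there is a walk of length ≤ k from u to v).
  data Within : ℕ → V → V → Set where
    here : ∀ {k v} → Within k v v
    step : ∀ {k u w v} → Adj u w → Within k w v → Within (suc k) u v

  -- (b_1,…,b_t) is a burning sequence: every vertex v satisfies
  -- d(v, b_i) ≤ t - i for some i (1-based; here index i : Fin t is 0-based,
  -- so t - (i+1)).
  IsBurningSeq : (t : ℕ) → Vec V t → Set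
  IsBurningSeq t bs = ∀ v → ∃[ i ] Within (t ∸ suc (toℕ i)) v (lookup bs i)

  BurningNumber : ℕ → Set
  BurningNumber k =
    (Σ[ bs ∈ Vec V k ] IsBurningSeq k bs) ×
    (∀ m (bs : Vec V m) → IsBurningSeq m bs → k ≤ m)

module _ (G : SimpleGraph) where
  open SimpleGraph G

  toGraph : Graph
  toGraph = record { V = Fin n ; Adj = λ u v → adj u v ≡ true }

  -- Edges of G: pairs (u , v) with u < v and u ~ v (each edge once).
  Edge : Set
  Edge = Σ[ u ∈ Fin n ] Σ[ v ∈ Fin n ] (u <ᶠ v × adj u v ≡ true)

  LAdj : Edge → Edge → Set
  LAdj (u , v , _) (x , y , _) =
    ¬ (_≡_ {A = Fin n × Fin n} (u , v) (x , y)) ×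
    (u ≡ x ⊎ u ≡ y ⊎ v ≡ x ⊎ v ≡ y)

  lineGraph : Graph
  lineGraph = record { V = Edge ; Adj = LAdj }

-- Let (b₁,…,b_k) burn G and let f be any edge. Replace each bᵢ by an edge incident
-- to it (f if bᵢ is isolated) and append f. An edge uv is reached from u by a walk
-- of length d ≤ k − i ending at bᵢ; walking along its edges gives a walk of length
-- d + 1 in L(G) from uv to the chosen edge at bᵢ, which is within the radius
-- k + 1 − i that this edge has in the longer sequence. If G has no edge, L(G) is
-- empty and b_L(G) = 0.
module Submission where

open import Defs
open import Data.Nat using (ℕ; suc; _+_; _∸_; _≤_; z≤n; s≤s)
open import Data.Nat.Properties using (≤-trans; m≤n+m; +-∸-assoc)
open import Data.Fin using (Fin; toℕ; inject₁) renaming (zero to fzero; suc to fsuc)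
open import Data.Fin.Properties using (_<?_; <-cmp; any?; toℕ-inject₁; toℕ<n; <-irrelevant)
  renaming (_≟_ to _≟ᶠ_)
open import Data.Vec using (Vec; []; _∷_; _∷ʳ_; lookup; map)
open import Data.Vec.Properties using (lookup-map)
open import Data.Bool using (true)
open import Data.Bool.Properties using () renaming (_≟_ to _≟ᵇ_)
open import Data.Product using (Σ-syntax; ∃-syntax; _×_; _,_; proj₁; proj₂)
open import Data.Product.Properties using (≡-dec)
open import Data.Sum using (_⊎_; inj₁; inj₂)
open import Data.Empty using (⊥-elim)
open import Relation.Nullary using (Dec; yes; no; _×-dec_)
open import Relation.Binary using (tri<; tri≈; tri>)
open import Relation.Binary.PropositionalEquality using (_≡_; refl; sym; trans; cong; subst₂)
open import Axiom.UniquenessOfIdentityProofs using (module Decidable⇒UIP)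

module _ (H : Graph) where

  Within-mono : ∀ {a b x y} → a ≤ b → Within H a x y → Within H b x y
  Within-mono _         here         = here
  Within-mono (s≤s a≤b) (step xw wy) = step xw (Within-mono a≤b wy)

  Within-++ : ∀ {a b x y z} → Within H a x y → Within H b y z → Within H (a + b) x z
  Within-++ {a} {b} here         yz = Within-mono (m≤n+m b a) yz
  Within-++         (step xw wy) yz = step xw (Within-++ wy yz)

lookup-∷ʳ-inject₁ : ∀ {A : Set} {t} (xs : Vec A t) (x : A) (i : Fin t) →
                    lookup (xs ∷ʳ x) (inject₁ i) ≡ lookup xs i
lookup-∷ʳ-inject₁ (y ∷ ys) x fzero    = refl
lookup-∷ʳ-inject₁ (y ∷ ys) x (fsuc i) = lookup-∷ʳ-inject₁ ys x i

burningRadius-inject₁ : ∀ {t} (i : Fin t) →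
                        suc (t ∸ suc (toℕ i)) ≡ suc t ∸ suc (toℕ (inject₁ i))
burningRadius-inject₁ {t} i =
  trans (sym (+-∸-assoc 1 (toℕ<n i))) (cong (t ∸_) (sym (toℕ-inject₁ i)))

module _ (H H′ : Graph) (f : Graph.V H′ → Graph.V H) (g : Graph.V H → Graph.V H′)
         (within-suc : ∀ {d} e b → Within H d (f e) b → Within H′ (suc d) e (g b)) where

  IsBurningSeq-map-∷ʳ : ∀ {t} (bs : Vec (Graph.V H) t) → IsBurningSeq H t bs →
                        (x : Graph.V H′) → IsBurningSeq H′ (suc t) (map g bs ∷ʳ x)
  IsBurningSeq-map-∷ʳ bs burns x e with burns (f e)
  ... | i , fe-near-bᵢ =
    inject₁ i ,
    subst₂ (λ r b → Within H′ r e b) (burningRadius-inject₁ i) (sym lookup-lifted)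
      (within-suc e (lookup bs i) fe-near-bᵢ)
    where
      lookup-lifted : lookup (map g bs ∷ʳ x) (inject₁ i) ≡ g (lookup bs i)
      lookup-lifted = trans (lookup-∷ʳ-inject₁ (map g bs) x i) (lookup-map i g bs)

module _ (G : SimpleGraph) where
  open SimpleGraph G hiding (sym)

  _∈ᵉ_ : Fin n → Edge G → Set
  c ∈ᵉ (x , y , _) = x ≡ c ⊎ y ≡ c

  edge? : Dec (Edge G)
  edge? = any? λ u → any? λ v → u <? v ×-dec adj u v ≟ᵇ true

  Edge-≡ : (e f : Edge G) → (proj₁ e , proj₁ (proj₂ e)) ≡ (proj₁ f , proj₁ (proj₂ f)) → e ≡ f
  Edge-≡ (x , y , x<y , xy) (.x , .y , x<y′ , xy′) refl
    rewrite <-irrelevant x<y x<y′ | Decidable⇒UIP.≡-irrelevant _≟ᵇ_ xy xy′ = refl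

  sharedEnd⇒Within₁ : ∀ {c} (e f : Edge G) → c ∈ᵉ e → c ∈ᵉ f → Within (lineGraph G) 1 e f
  sharedEnd⇒Within₁ e@(x , y , _) f@(x′ , y′ , _) c∈e c∈f
    with ≡-dec _≟ᶠ_ _≟ᶠ_ (x , y) (x′ , y′)
  ... | yes same rewrite Edge-≡ e f same = here
  ... | no  differ = step (differ , common c∈e c∈f) here
    where
      common : ∀ {c} → x ≡ c ⊎ y ≡ c → x′ ≡ c ⊎ y′ ≡ c → x ≡ x′ ⊎ x ≡ y′ ⊎ y ≡ x′ ⊎ y ≡ y′
      common (inj₁ xc) (inj₁ x′c) = inj₁ (trans xc (sym x′c))
      common (inj₁ xc) (inj₂ y′c) = inj₂ (inj₁ (trans xc (sym y′c)))
      common (inj₂ yc) (inj₁ x′c) = inj₂ (inj₂ (inj₁ (trans yc (sym x′c))))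
      common (inj₂ yc) (inj₂ y′c) = inj₂ (inj₂ (inj₂ (trans yc (sym y′c))))

  edgeBetween : ∀ u w → adj u w ≡ true → Σ[ e ∈ Edge G ] (u ∈ᵉ e × w ∈ᵉ e)
  edgeBetween u w uw with <-cmp u w
  ... | tri< u<w _ _ = (u , w , u<w , uw) , inj₁ refl , inj₂ refl
  ... | tri≈ _ refl _ = ⊥-elim (irrefl u uw)
  ... | tri> _ _ w<u = (w , u , w<u , trans (SimpleGraph.sym G w u) uw) , inj₂ refl , inj₁ refl

  endpoint⇒neighbour : ∀ {c} (e : Edge G) → c ∈ᵉ e → ∃[ w ] adj c w ≡ true
  endpoint⇒neighbour (x , y , _ , xy) (inj₁ refl) = y , xy
  endpoint⇒neighbour (x , y , _ , xy) (inj₂ refl) = x , trans (SimpleGraph.sym G y x) xy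

  -- Some edge at c, with the junk value e₀ when c is isolated.
  module _ (e₀ : Edge G) where

    incidentEdge : Fin n → Edge G
    incidentEdge c with any? (λ w → adj c w ≟ᵇ true)
    ... | yes (w , cw) = proj₁ (edgeBetween c w cw)
    ... | no  _        = e₀

    incidentEdge-∈ᵉ : ∀ {c} (e : Edge G) → c ∈ᵉ e → c ∈ᵉ incidentEdge c
    incidentEdge-∈ᵉ {c} e c∈e with any? (λ w → adj c w ≟ᵇ true)
    ... | yes (w , cw) = proj₁ (proj₂ (edgeBetween c w cw))
    ... | no  isolated = ⊥-elim (isolated (endpoint⇒neighbour e c∈e))

    Within⇒Within-lineGraph : ∀ {d u b} (e : Edge G) → u ∈ᵉ e → Within (toGraph G) d u b →
                              Within (lineGraph G) (suc d) e (incidentEdge b)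
    Within⇒Within-lineGraph e b∈e here =
      Within-mono (lineGraph G) (s≤s z≤n)
        (sharedEnd⇒Within₁ e (incidentEdge _) b∈e (incidentEdge-∈ᵉ e b∈e))
    Within⇒Within-lineGraph e u∈e (step {w = w} uw wb) with edgeBetween _ w uw
    ... | f , u∈f , w∈f =
      Within-++ (lineGraph G) (sharedEnd⇒Within₁ e f u∈e u∈f) (Within⇒Within-lineGraph f w∈f wb)

lemma6 : (G : SimpleGraph) (k m : ℕ) →
         BurningNumber (toGraph G) k →
         BurningNumber (lineGraph G) m →
         m ≤ suc k
lemma6 G k m ((bs , burns) , _) (_ , minimalL) with edge? G
... | yes e₀ =
  minimalL (suc k) (map (incidentEdge G e₀) bs ∷ʳ e₀)
    (IsBurningSeq-map-∷ʳ (toGraph G) (lineGraph G) proj₁ (incidentEdge G e₀)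
       (λ e _ → Within⇒Within-lineGraph G e₀ e (inj₁ refl)) bs burns e₀)
... | no noEdge = ≤-trans (minimalL 0 [] (λ e → ⊥-elim (noEdge e))) z≤n
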